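{- Let $f(x)$ be a separable polynomial of degree $d$ over a discretely valued field $K$. Suppose $G_{k_f}(f)$ (which is the complete graph on $d$ vertices) and $d_1(f),\dots,d_{k_f}(f)$ are given, and fix a labelling $v_1,\dots,v_d$ of the vertices of $G_{k_f}(f)$. Then there is a labelling $x_1,\dots,x_d$ of the roots of $f(x)$ such that $\textup{ord}(x_i-x_j)=d_k(f)$ if and only if $w(v_iv_j)=k_f+1-k$ in $G_{k_f}(f)$. In particular, the set of tuples $\{(\textup{ord}(x_i-x_j),i,j):1\le i<j\le d\}$, up to reordering of the roots, is uniquely determined by the weighted graph $G_{k_f}(f)$ and $d_1(f),\dots,d_{k_f}(f)$.
   Context: $\textup{ord}$ is the normalised valuation of $K$, extended to $\bar K$. For roots $x_1,\dots,x_d\in\bar K$ of $f$: $d_n(f)$ is the $n$-th largest value in $\{\textup{ord}(x_i-x_j):i<j\}$ and $k_f$ is the number of distinct values. For $1\le n\le k_f$, the $n$-th auxiliary graph $G_n(f)=(V,E_n,w_n)$ is the weighted graph with vertices $v_1,\dots,v_d$ (with $v_i$ corresponding to $x_i$), edges $E_n=\{v_iv_j:\textup{ord}(x_i-x_j)\ge d_n(f)\}$, and weights $w_n(v_iv_j)=n+1-m$ if $\textup{ord}(x_i-x_j)=d_m(f)$; it is regarded as an unlabelled weighted graph. -}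

module Defs where

open import Level using (Level; _⊔_) renaming (suc to lsuc)
open import Algebra.Bundles using (CommutativeRing)
open import Data.Nat as ℕ using (ℕ; zero; suc; _∸_)
open import Data.Integer as ℤ using (ℤ)
open import Data.Rational as ℚ using (ℚ)
import Data.Rational.Properties as ℚP
open import Data.Fin as Fin using (Fin; toℕ)
open import Data.Fin.Permutation using (Permutation′; _⟨$⟩ʳ_)
open import Data.Vec as Vec using (Vec)
open import Data.List as List using (List; length; lookup; filter; reverse; deduplicate; findIndex; allFin; concatMap; map)
open import Data.List.Sort ℚP.≤-decTotalOrder using (sort)
open import Data.Maybe using (Maybe; just; nothing)
open import Data.Product using (Σ; ∃; _×_; _,_; proj₁)
open import Relation.Nullary using (¬_; yes; no)
open import Relation.Binary.PropositionalEquality using (_≡_)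

record Field (c ℓ : Level) : Set (lsuc (c ⊔ ℓ)) where
  field
    commutativeRing : CommutativeRing c ℓ
  open CommutativeRing commutativeRing public
  field
    1≉0     : ¬ (1# ≈ 0#)
    inverse : ∀ a → ¬ (a ≈ 0#) → ∃ λ b → (a * b) ≈ 1#

-- Polynomials of degree d: coefficient vectors (a₀ , … , a_d),
-- evaluation by Horner's rule.

module _ {c ℓ} (R : CommutativeRing c ℓ) where
  open CommutativeRing R
  evalPoly : ∀ {n} → Vec Carrier n → Carrier → Carrier
  evalPoly p y = Vec.foldr _ (λ a acc → a + (y * acc)) 0# p

leading : ∀ {a} {A : Set a} {d} → Vec A (suc d) → A
leading = Vec.last

-- A discrete (normalised) valuation on a field K.
-- ord is only meaningful on nonzero elements (ord 0 is a junk value).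

record DiscreteValuation {c ℓ} (K : Field c ℓ) : Set (c ⊔ ℓ) where
  open Field K
  field
    ord      : Carrier → ℤ
    ord-cong : ∀ {a b} → ¬ (a ≈ 0#) → a ≈ b → ord a ≡ ord b
    ord-mul  : ∀ a b → ¬ (a ≈ 0#) → ¬ (b ≈ 0#) → ord (a * b) ≡ ord a ℤ.+ ord b
    ord-add  : ∀ a b → ¬ (a ≈ 0#) → ¬ (b ≈ 0#) → ¬ ((a + b) ≈ 0#) →
               (ord a ℤ.⊓ ord b) ℤ.≤ ord (a + b)
    ord-surj : ∀ n → ∃ λ a → ¬ (a ≈ 0#) × ord a ≡ n

record ValuedAlgebraicClosure {c ℓ} (K : Field c ℓ) (v : DiscreteValuation K)
       (c′ ℓ′ : Level) : Set (lsuc (c ⊔ ℓ ⊔ c′ ⊔ ℓ′)) where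
  private module K = Field K
  private module v = DiscreteValuation v
  field
    L : Field c′ ℓ′
  open Field L public
  field
    ι       : K.Carrier → Carrier
    ι-cong  : ∀ {a b} → a K.≈ b → ι a ≈ ι b
    ι-+     : ∀ a b → ι (a K.+ b) ≈ (ι a + ι b)
    ι-*     : ∀ a b → ι (a K.* b) ≈ (ι a * ι b)
    ι-1     : ι K.1# ≈ 1#
    algClosed : ∀ n (p : Vec Carrier (suc (suc n))) → ¬ (leading p ≈ 0#) →
                ∃ λ y → evalPoly commutativeRing p y ≈ 0#
    algebraic : ∀ y → ∃ λ n → Σ (Vec K.Carrier (suc n)) λ p →
                ¬ (leading p K.≈ K.0#) × evalPoly commutativeRing (Vec.map ι p) y ≈ 0#
    ord      : Carrier → ℚ
    ord-cong : ∀ {a b} → ¬ (a ≈ 0#) → a ≈ b → ord a ≡ ord b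
    ord-mul  : ∀ a b → ¬ (a ≈ 0#) → ¬ (b ≈ 0#) → ord (a * b) ≡ ord a ℚ.+ ord b
    ord-add  : ∀ a b → ¬ (a ≈ 0#) → ¬ (b ≈ 0#) → ¬ ((a + b) ≈ 0#) →
               (ord a ℚ.⊓ ord b) ℚ.≤ ord (a + b)
    ord-ext  : ∀ a → ¬ (a K.≈ K.0#) → ord (ι a) ≡ (v.ord a ℚ./ 1)

record SepPolyWithRoots (c ℓ c′ ℓ′ : Level) (d : ℕ) : Set (lsuc (c ⊔ ℓ ⊔ c′ ⊔ ℓ′)) where
  field
    K    : Field c ℓ
    v    : DiscreteValuation K
    Kbar : ValuedAlgebraicClosure K v c′ ℓ′
  open ValuedAlgebraicClosure Kbar public
  private module K = Field K
  field
    f          : Vec K.Carrier (suc d)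
    f-degree   : ¬ (leading f K.≈ K.0#)
    x          : Fin d → Carrier
    x-injective : ∀ i j → x i ≈ x j → i ≡ j
    x-root     : ∀ i → evalPoly commutativeRing (Vec.map ι f) (x i) ≈ 0#
    x-all      : ∀ y → evalPoly commutativeRing (Vec.map ι f) y ≈ 0# → ∃ λ i → y ≈ x i

module RootData {c ℓ} (L : Field c ℓ) (ord : Field.Carrier L → ℚ) {d : ℕ}
                (y : Fin d → Field.Carrier L) where
  open Field L using (_-_)

  odist : Fin d → Fin d → ℚ
  odist i j with i Fin.<? j
  ... | yes _ = ord (y i - y j)
  ... | no  _ = ord (y j - y i)

  pairs : List (Fin d × Fin d)
  pairs = concatMap (λ i → map (λ j → (i , j)) (filter (i Fin.<?_) (allFin d))) (allFin d)

  dList : List ℚ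
  dList = reverse (sort (deduplicate ℚP._≟_ (map (λ p → odist (proj₁ p) (Data.Product.proj₂ p)) pairs)))
    where import Data.Product

  kf : ℕ
  kf = length dList

  -- d_{n+1}(f) = dval n   (0-indexed: n : Fin kf)
  dval : Fin kf → ℚ
  dval = lookup dList

  -- the n-th auxiliary graph; the index n : Fin kf stands for the
  -- paper's n' = toℕ n + 1.  A weighted graph on Fin d is a function
  -- Fin d → Fin d → Maybe ℕ (nothing = no edge, just w = edge of weight w).
  -- Edge v_i v_j (i ≠ j) iff ord ≥ d_{n'}; if ord = d_{m'} its weight is n' + 1 - m'.
  auxGraph : Fin kf → Fin d → Fin d → Maybe ℕ
  auxGraph n i j with i Fin.≟ j
  ... | yes _ = nothing
  ... | no _ with dval n ℚP.≤? odist i j | findIndex (ℚP._≟ odist i j) dList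
  ...   | yes _ | just m = just (suc (toℕ n) ∸ toℕ m)
  ...   | yes _ | nothing = nothing
  ...   | no _  | _ = nothing

WGraph : ℕ → Set
WGraph d = Fin d → Fin d → Maybe ℕ

_≅ᵂ_ : ∀ {d} → WGraph d → WGraph d → Set
_≅ᵂ_ {d} H G = ∃ λ (σ : Permutation′ d) → ∀ i j → H i j ≡ G (σ ⟨$⟩ʳ i) (σ ⟨$⟩ʳ j)

-- In the top auxiliary graph G_{k_f} the threshold d_{k_f} is the least distance, so every pair of
-- distinct vertices is joined, and the edge v_i v_j has weight k_f − m where ord(x_i − x_j) is
-- the (m+1)-st entry of d_1 > … > d_{k_f}.  As these values are distinct, the weight of an edge
-- determines the distance of its endpoints, so an isomorphism H ≅ G_{k_f} is itself a labelling of
-- the roots with the required distances.  Ordering of pairs is harmless since ord(−1) = 0 makes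
-- ord(x_i − x_j) symmetric.

module Submission where

open import Defs
open import Level using (Level)
open import Data.Nat using (ℕ; suc; _∸_)
open import Data.Fin using (Fin; toℕ; _<_)
open import Data.Fin.Permutation using (Permutation′; _⟨$⟩ʳ_)
open import Data.Maybe using (just)
open import Data.Product using (∃)
open import Data.Product using (_×_)
open import Function.Bundles using (_⇔_)
open import Relation.Binary.PropositionalEquality using (_≡_)

open import Data.Empty using (⊥-elim)
open import Data.Nat using (pred)
open import Data.Fin as Fin using (zero; suc)
import Data.Fin.Properties as FinP
open import Data.List using (List; []; _∷_; _∷ʳ_; length; lookup; reverse; findIndex; filter; allFin; map)
open import Data.List.Membership.Propositional using (_∈_)
open import Data.List.Membership.Propositional.Properties
  using (∈-lookup; ∈-map⁺; ∈-concat⁺′; ∈-filter⁺; ∈-allFin; ∈-deduplicate⁺)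
open import Data.List.Properties using (unfold-reverse)
open import Data.List.Relation.Binary.Permutation.Propositional.Properties using (∈-resp-↭; ↭-reverse)
open import Data.List.Relation.Binary.Permutation.Propositional using (↭-sym; ↭⇒↭ₛ)
import Data.List.Relation.Binary.Permutation.Setoid.Properties as SetoidPermutation
import Data.List.Relation.Unary.All as All
open import Data.List.Relation.Unary.Any as Any using (Any; here; there)
open import Data.List.Relation.Unary.AllPairs using (_∷_)
open import Data.List.Relation.Unary.Linked using (Linked)
open import Data.List.Relation.Unary.Linked.Properties using (Linked⇒All)
open import Data.List.Relation.Unary.Unique.Propositional using (Unique)
open import Data.List.Relation.Unary.Unique.DecPropositional.Properties using (deduplicate-!)
open import Data.Maybe using (nothing)
open import Data.Maybe.Properties using (just-injective)
open import Data.Nat.Properties using (∸-cancelˡ-≡; <⇒≤)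
open import Data.Product using (Σ; _,_; proj₁; proj₂)
open import Data.Rational as ℚ using (ℚ)
import Data.Rational.Properties as ℚP
open import Data.List.Sort ℚP.≤-decTotalOrder using (sort; sort-↭; sort-↗)
open import Function.Base using (_∘_)
open import Function.Bundles using (mk⇔; Injection)
open import Function.Properties.Inverse using (Inverse⇒Injection)
open import Relation.Binary using (Rel; Reflexive; Transitive; tri<; tri≈; tri>)
import Relation.Binary.PropositionalEquality as ≡
open ≡ using (refl; cong; subst; _≢_)
open import Relation.Nullary using (¬_; yes; no)
open import Relation.Unary using (Pred; Decidable)
import Algebra.Properties.Group as GroupProperties
import Algebra.Properties.AbelianGroup as AbelianGroupProperties
import Algebra.Properties.Ring as RingProperties

p+p≡0⇒p≡0 : ∀ p → p ℚ.+ p ≡ ℚ.0ℚ → p ≡ ℚ.0ℚ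
p+p≡0⇒p≡0 p p+p≡0 with ℚP.<-cmp p ℚ.0ℚ
... | tri≈ _ p≡0 _ = p≡0
... | tri< p<0 _ _ = ⊥-elim (ℚP.<-irrefl p+p≡0 (ℚP.+-mono-< p<0 p<0))
... | tri> _ _ p>0 = ⊥-elim (ℚP.<-irrefl (≡.sym p+p≡0) (ℚP.+-mono-< p>0 p>0))

∸-toℕ-injective : ∀ {n} (m k : Fin n) → n ∸ toℕ m ≡ n ∸ toℕ k → m ≡ k
∸-toℕ-injective m k eq =
  FinP.toℕ-injective (∸-cancelˡ-≡ (<⇒≤ (FinP.toℕ<n m)) (<⇒≤ (FinP.toℕ<n k)) eq)

module _ {a} {A : Set a} where

  lookup-injective : ∀ {xs : List A} → Unique xs → ∀ m k → lookup xs m ≡ lookup xs k → m ≡ k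
  lookup-injective {_ ∷ _} _            zero    zero    _  = refl
  lookup-injective {_ ∷ _} (x∉ ∷ _)     zero    (suc k) eq = ⊥-elim (All.lookup x∉ (∈-lookup k) eq)
  lookup-injective {_ ∷ _} (x∉ ∷ _)     (suc m) zero    eq = ⊥-elim (All.lookup x∉ (∈-lookup m) (≡.sym eq))
  lookup-injective {_ ∷ _} (_ ∷ unique) (suc m) (suc k) eq = cong suc (lookup-injective unique m k eq)

  lookup-cong-fromEnd : ∀ {xs ys : List A} → xs ≡ ys →
    (m : Fin (length xs)) (k : Fin (length ys)) →
    length xs ∸ toℕ m ≡ length ys ∸ toℕ k → lookup xs m ≡ lookup ys k
  lookup-cong-fromEnd {xs} refl m k eq = cong (lookup xs) (∸-toℕ-injective m k eq)

  lookup-∷ʳ-last : ∀ xs (x : A) (t : Fin (length (xs ∷ʳ x))) →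
    suc (toℕ t) ≡ length (xs ∷ʳ x) → lookup (xs ∷ʳ x) t ≡ x
  lookup-∷ʳ-last []          x zero    _    = refl
  lookup-∷ʳ-last (_ ∷ [])     x zero    ()
  lookup-∷ʳ-last (_ ∷ _ ∷ _)  x zero    ()
  lookup-∷ʳ-last (_ ∷ xs)     x (suc t) last = lookup-∷ʳ-last xs x t (cong pred last)

  lookup-reverse-last : ∀ (x : A) xs (t : Fin (length (reverse (x ∷ xs)))) →
    suc (toℕ t) ≡ length (reverse (x ∷ xs)) → lookup (reverse (x ∷ xs)) t ≡ x
  lookup-reverse-last x xs t last with reverse (x ∷ xs) | unfold-reverse x xs
  ... | _ | refl = lookup-∷ʳ-last (reverse xs) x t last

  module _ {p} {P : Pred A p} (P? : Decidable P) where

    findIndex-just : ∀ xs {m} → findIndex P? xs ≡ just m → P (lookup xs m)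
    findIndex-just (x ∷ xs) eq with P? x
    findIndex-just (x ∷ xs) refl | yes px = px
    ... | no _ with findIndex P? xs in found
    findIndex-just (x ∷ xs) refl | no _ | just _ = findIndex-just xs found

    findIndex-nothing : ∀ {xs} → Any P xs → findIndex P? xs ≢ nothing
    findIndex-nothing {x ∷ xs} any eq with P? x
    findIndex-nothing {x ∷ xs} any () | yes _
    findIndex-nothing {x ∷ xs} (here px)   eq | no ¬px = ¬px px
    findIndex-nothing {x ∷ xs} (there any) eq | no _ with findIndex P? xs in found
    findIndex-nothing {x ∷ xs} (there any) () | no _ | just _
    ... | nothing = findIndex-nothing any found

  module _ {r} {R : Rel A r} (R-refl : Reflexive R) (R-trans : Transitive R) where

    lookup-reverse-last-minimal : ∀ {xs} → Linked R xs →
      (t : Fin (length (reverse xs))) → suc (toℕ t) ≡ length (reverse xs) →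
      ∀ {z} → z ∈ reverse xs → R (lookup (reverse xs) t) z
    lookup-reverse-last-minimal {w ∷ ws} sorted t last z∈ =
      subst (λ u → R u _) (≡.sym (lookup-reverse-last w ws t last))
        (All.lookup (Linked⇒All R-trans R-refl sorted) (∈-resp-↭ (↭-reverse (w ∷ ws)) z∈))

module _ {c ℓ} (L : Field c ℓ) where
  open Field L

  private
    module + = GroupProperties +-group
    module ℚ+ = GroupProperties ℚP.+-0-group

  -1#≉0# : ¬ (- 1# ≈ 0#)
  -1#≉0# -1≈0 = 1≉0 (trans (sym (+.⁻¹-involutive 1#)) (trans (-‿cong -1≈0) +.ε⁻¹≈ε))

  -1#*-1#≈1# : (- 1# * - 1#) ≈ 1#
  -1#*-1#≈1# = trans (RingProperties.-1*x≈-x ring (- 1#)) (+.⁻¹-involutive 1#)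

  y-x≈-1#*[x-y] : ∀ x y → (y - x) ≈ (- 1# * (x - y))
  y-x≈-1#*[x-y] x y = trans (sym (AbelianGroupProperties.⁻¹-anti-homo‿- +-abelianGroup x y))
                            (sym (RingProperties.-1*x≈-x ring (x - y)))

  x≉y⇒x-y≉0# : ∀ {x y} → ¬ (x ≈ y) → ¬ ((x - y) ≈ 0#)
  x≉y⇒x-y≉0# x≉y x-y≈0 = x≉y (+.x∙y⁻¹≈ε⇒x≈y _ _ x-y≈0)

  module MultiplicativeValuation (ord : Carrier → ℚ)
    (ord-cong : ∀ {a b} → ¬ (a ≈ 0#) → a ≈ b → ord a ≡ ord b)
    (ord-mul  : ∀ a b → ¬ (a ≈ 0#) → ¬ (b ≈ 0#) → ord (a * b) ≡ ord a ℚ.+ ord b)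
    where
    open ≡.≡-Reasoning

    ord-1# : ord 1# ≡ ℚ.0ℚ
    ord-1# = ℚ+.identityˡ-unique (ord 1#) (ord 1#) (begin
      ord 1# ℚ.+ ord 1#  ≡⟨ ord-mul 1# 1# 1≉0 1≉0 ⟨
      ord (1# * 1#)      ≡⟨ ord-cong 1≉0 (sym (*-identityˡ 1#)) ⟨
      ord 1#             ∎)

    ord-[-1#] : ord (- 1#) ≡ ℚ.0ℚ
    ord-[-1#] = p+p≡0⇒p≡0 (ord (- 1#)) (begin
      ord (- 1#) ℚ.+ ord (- 1#)  ≡⟨ ord-mul (- 1#) (- 1#) -1#≉0# -1#≉0# ⟨
      ord (- 1# * - 1#)          ≡⟨ ord-cong 1≉0 (sym -1#*-1#≈1#) ⟨
      ord 1#                     ≡⟨ ord-1# ⟩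
      ℚ.0ℚ                       ∎)

    ord-[x-y]-comm : ∀ {x y} → ¬ (x ≈ y) → ord (x - y) ≡ ord (y - x)
    ord-[x-y]-comm {x} {y} x≉y = begin
      ord (x - y)                   ≡⟨ ℚP.+-identityˡ _ ⟨
      ℚ.0ℚ ℚ.+ ord (x - y)          ≡⟨ cong (ℚ._+ ord (x - y)) ord-[-1#] ⟨
      ord (- 1#) ℚ.+ ord (x - y)    ≡⟨ ord-mul (- 1#) (x - y) -1#≉0# (x≉y⇒x-y≉0# x≉y) ⟨
      ord (- 1# * (x - y))          ≡⟨ ord-cong (x≉y⇒x-y≉0# (x≉y ∘ sym)) (y-x≈-1#*[x-y] x y) ⟨
      ord (y - x)                   ∎

module RootDataProperties {c ℓ} (L : Field c ℓ) (ord : Field.Carrier L → ℚ) {d : ℕ}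
                          (y : Fin d → Field.Carrier L) where
  open Field L using (_-_)
  open RootData L ord y

  odist-< : ∀ {i j} → i < j → odist i j ≡ ord (y i - y j)
  odist-< {i} {j} i<j with i Fin.<? j
  ... | yes _   = refl
  ... | no i≮j = ⊥-elim (i≮j i<j)

  odist-> : ∀ {i j} → j < i → odist i j ≡ ord (y j - y i)
  odist-> {i} {j} j<i with i Fin.<? j
  ... | yes i<j = ⊥-elim (FinP.<-asym i<j j<i)
  ... | no _    = refl

  odist-comm : ∀ i j → odist i j ≡ odist j i
  odist-comm i j with FinP.<-cmp i j
  ... | tri< i<j _ _ = ≡.trans (odist-< i<j) (≡.sym (odist-> i<j))
  ... | tri≈ _ refl _ = refl
  ... | tri> _ _ j<i = ≡.trans (odist-> j<i) (≡.sym (odist-< j<i))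

  odist∈dList-< : ∀ {i j} → i < j → odist i j ∈ dList
  odist∈dList-< {i} {j} i<j =
    ∈-resp-↭ (↭-sym (↭-reverse _)) (∈-resp-↭ (↭-sym (sort-↭ _)) (∈-deduplicate⁺ ℚP._≟_
      (∈-map⁺ (λ p → odist (proj₁ p) (proj₂ p)) (∈-concat⁺′
        (∈-map⁺ (i ,_) (∈-filter⁺ (i Fin.<?_) (∈-allFin j) i<j))
        (∈-map⁺ (λ i → map (i ,_) (filter (i Fin.<?_) (allFin d))) (∈-allFin i))))))

  odist∈dList : ∀ {i j} → i ≢ j → odist i j ∈ dList
  odist∈dList {i} {j} i≢j with FinP.<-cmp i j
  ... | tri< i<j _ _ = odist∈dList-< i<j
  ... | tri≈ _ i≡j _ = ⊥-elim (i≢j i≡j)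
  ... | tri> _ _ j<i = subst (_∈ dList) (odist-comm j i) (odist∈dList-< j<i)

  dList-unique : Unique dList
  dList-unique = SetoidPermutation.Unique-resp-↭ (≡.setoid ℚ) (↭⇒↭ₛ (↭-sym (↭-reverse _)))
    (SetoidPermutation.Unique-resp-↭ (≡.setoid ℚ) (↭⇒↭ₛ (↭-sym (sort-↭ _))) (deduplicate-! ℚP._≟_ _))

  dval-last-minimal : (top : Fin kf) → suc (toℕ top) ≡ kf → ∀ {z} → z ∈ dList → dval top ℚ.≤ z
  dval-last-minimal = lookup-reverse-last-minimal ℚP.≤-refl ℚP.≤-trans (sort-↗ _)

  auxGraph-last : (top : Fin kf) → suc (toℕ top) ≡ kf → ∀ {i j} → i ≢ j →
    Σ (Fin kf) λ m → (auxGraph top i j ≡ just (kf ∸ toℕ m)) × (dval m ≡ odist i j)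
  auxGraph-last top last {i} {j} i≢j with i Fin.≟ j
  ... | yes i≡j = ⊥-elim (i≢j i≡j)
  ... | no _ with dval top ℚP.≤? odist i j | findIndex (ℚP._≟ odist i j) dList in found
  ... | yes _ | just m  = m , cong (λ n → just (n ∸ toℕ m)) last , findIndex-just (ℚP._≟ odist i j) dList found
  ... | yes _ | nothing = ⊥-elim (findIndex-nothing (ℚP._≟ odist i j) (Any.map ≡.sym (odist∈dList i≢j)) found)
  ... | no top≰ | _     = ⊥-elim (top≰ (dval-last-minimal top last (odist∈dList i≢j)))

  auxGraph-last-weight : (top : Fin kf) → suc (toℕ top) ≡ kf → ∀ {i j} → i ≢ j → ∀ k →
    (odist i j ≡ dval k) ⇔ (auxGraph top i j ≡ just (kf ∸ toℕ k))
  auxGraph-last-weight top last i≢j k with auxGraph-last top last i≢j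
  ... | m , weight , dval-m = mk⇔
    (λ odist≡ → ≡.trans weight (cong (λ n → just (kf ∸ toℕ n))
                  (lookup-injective dList-unique m k (≡.trans dval-m odist≡))))
    (λ weight′ → ≡.trans (≡.sym dval-m) (cong dval
                  (∸-toℕ-injective m k (just-injective (≡.trans (≡.sym weight) weight′)))))

⟨$⟩ʳ-≢ : ∀ {d} (σ : Permutation′ d) {i j} → i ≢ j → σ ⟨$⟩ʳ i ≢ σ ⟨$⟩ʳ j
⟨$⟩ʳ-≢ σ i≢j = i≢j ∘ Injection.injective (Inverse⇒Injection σ)

module _ {c ℓ c′ ℓ′ : Level} {d : ℕ} (P : SepPolyWithRoots c ℓ c′ ℓ′ d) where
  open SepPolyWithRoots P
  open RootData L ord x
  open RootDataProperties L ord x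
  open MultiplicativeValuation L ord ord-cong ord-mul

  ord-[x-x]≡odist : ∀ {i j} → i ≢ j → ord (x i - x j) ≡ odist i j
  ord-[x-x]≡odist {i} {j} i≢j with FinP.<-cmp i j
  ... | tri< i<j _ _ = ≡.sym (odist-< i<j)
  ... | tri≈ _ i≡j _ = ⊥-elim (i≢j i≡j)
  ... | tri> _ _ j<i = ≡.trans (ord-[x-y]-comm (i≢j ∘ x-injective i j)) (≡.sym (odist-> j<i))

  labelling-from-auxGraph-last : (top : Fin kf) → suc (toℕ top) ≡ kf →
    (H : WGraph d) → H ≅ᵂ auxGraph top →
    ∃ λ (π : Permutation′ d) → ∀ (i j : Fin d) → i < j → ∀ (k : Fin kf) →
      (ord (x (π ⟨$⟩ʳ i) - x (π ⟨$⟩ʳ j)) ≡ dval k) ⇔ (H i j ≡ just (kf ∸ toℕ k))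
  labelling-from-auxGraph-last top last H (σ , H≡) = σ , weight-of
    where
    weight-of : ∀ i j → i < j → ∀ k →
      (ord (x (σ ⟨$⟩ʳ i) - x (σ ⟨$⟩ʳ j)) ≡ dval k) ⇔ (H i j ≡ just (kf ∸ toℕ k))
    weight-of i j i<j k
      rewrite ord-[x-x]≡odist (⟨$⟩ʳ-≢ σ (FinP.<⇒≢ i<j)) | H≡ i j
      = auxGraph-last-weight top last (⟨$⟩ʳ-≢ σ (FinP.<⇒≢ i<j)) k

module _ {c ℓ c′ ℓ′ c₂ ℓ₂ c₂′ ℓ₂′ : Level} {d : ℕ}
         (P : SepPolyWithRoots c ℓ c′ ℓ′ d) (Q : SepPolyWithRoots c₂ ℓ₂ c₂′ ℓ₂′ d) where
  private
    module P = SepPolyWithRoots P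
    module Q = SepPolyWithRoots Q
    module PL = Field P.L
    module QL = Field Q.L
    module PR = RootData P.L P.ord P.x
    module QR = RootData Q.L Q.ord Q.x
    module PRP = RootDataProperties P.L P.ord P.x
    module QRP = RootDataProperties Q.L Q.ord Q.x

  distances-from-auxGraph-last : (topP : Fin PR.kf) → suc (toℕ topP) ≡ PR.kf →
    (topQ : Fin QR.kf) → suc (toℕ topQ) ≡ QR.kf →
    PR.dList ≡ QR.dList → QR.auxGraph topQ ≅ᵂ PR.auxGraph topP →
    ∃ λ (π : Permutation′ d) → ∀ (i j : Fin d) → i < j →
      P.ord (P.x (π ⟨$⟩ʳ i) PL.- P.x (π ⟨$⟩ʳ j)) ≡ Q.ord (Q.x i QL.- Q.x j)
  distances-from-auxGraph-last topP lastP topQ lastQ dP≡dQ (σ , Q≡P) = σ , distance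
    where
    distance : ∀ i j → i < j → P.ord (P.x (σ ⟨$⟩ʳ i) PL.- P.x (σ ⟨$⟩ʳ j)) ≡ Q.ord (Q.x i QL.- Q.x j)
    distance i j i<j
      with PRP.auxGraph-last topP lastP (⟨$⟩ʳ-≢ σ (FinP.<⇒≢ i<j))
         | QRP.auxGraph-last topQ lastQ (FinP.<⇒≢ i<j)
    ... | mP , weightP , dval-mP | mQ , weightQ , dval-mQ = begin
      P.ord (P.x (σ ⟨$⟩ʳ i) PL.- P.x (σ ⟨$⟩ʳ j)) ≡⟨ ord-[x-x]≡odist P (⟨$⟩ʳ-≢ σ (FinP.<⇒≢ i<j)) ⟩
      PR.odist (σ ⟨$⟩ʳ i) (σ ⟨$⟩ʳ j)             ≡⟨ dval-mP ⟨
      PR.dval mP                                  ≡⟨ lookup-cong-fromEnd dP≡dQ mP mQ same-weight ⟩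
      QR.dval mQ                                  ≡⟨ dval-mQ ⟩
      QR.odist i j                                ≡⟨ QRP.odist-< i<j ⟩
      Q.ord (Q.x i QL.- Q.x j)                    ∎
      where
      open ≡.≡-Reasoning
      same-weight : PR.kf ∸ toℕ mP ≡ QR.kf ∸ toℕ mQ
      same-weight = just-injective (≡.trans (≡.sym weightP) (≡.trans (≡.sym (Q≡P i j)) weightQ))

lemma2p9 : ∀ {c ℓ c′ ℓ′ c₂ ℓ₂ c₂′ ℓ₂′ : Level} {d : ℕ} →
  (∀ (P : SepPolyWithRoots c ℓ c′ ℓ′ d) →
    let open SepPolyWithRoots P
        open RootData L ord x
    in (top : Fin kf) → suc (toℕ top) ≡ kf →
       (H : WGraph d) → H ≅ᵂ auxGraph top →
       ∃ λ (π : Permutation′ d) → ∀ (i j : Fin d) → i < j → ∀ (k : Fin kf) →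
         (ord (x (π ⟨$⟩ʳ i) - x (π ⟨$⟩ʳ j)) ≡ dval k) ⇔ (H i j ≡ just (kf ∸ toℕ k)))
  ×
  (∀ (P : SepPolyWithRoots c ℓ c′ ℓ′ d) (Q : SepPolyWithRoots c₂ ℓ₂ c₂′ ℓ₂′ d) →
    let module P = SepPolyWithRoots P
        module Q = SepPolyWithRoots Q
        module PL = Field P.L
        module QL = Field Q.L
        module PR = RootData P.L P.ord P.x
        module QR = RootData Q.L Q.ord Q.x
    in (topP : Fin PR.kf) → suc (toℕ topP) ≡ PR.kf →
       (topQ : Fin QR.kf) → suc (toℕ topQ) ≡ QR.kf →
       PR.dList ≡ QR.dList →
       QR.auxGraph topQ ≅ᵂ PR.auxGraph topP →
       ∃ λ (π : Permutation′ d) → ∀ (i j : Fin d) → i < j →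
         P.ord (P.x (π ⟨$⟩ʳ i) PL.- P.x (π ⟨$⟩ʳ j)) ≡ Q.ord (Q.x i QL.- Q.x j))
lemma2p9 = labelling-from-auxGraph-last , distances-from-auxGraph-last
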